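{- Let $G$ be a connected finite simple graph with vertex set $\{1,\dots,p\}$ and $q$ edges. Then the $1$-skeleton of the graphicahedron $\mathcal{P}_G$ (the graph whose vertices are the rank-$0$ faces of $\mathcal{P}_G$, two being adjacent iff they are both below a common rank-$1$ face) is isomorphic to the Cayley graph $\mathcal{G}(G)$.
   Context: For an edge $e=\{i,j\}$ of $G$ let $\tau_e=(i\;j)\in S_p$. For $K\subseteq E(G)$ let $T_K=\langle \tau_e : e\in K\rangle\le S_p$ (trivial if $K=\emptyset$). The Cayley graph $\mathcal{G}(G)$ has vertex set $S_p$, with $\gamma_1,\gamma_2$ adjacent iff $\gamma_2=\tau_e\gamma_1$ for some edge $e$ of $G$. The graphicahedron $\mathcal{P}_G$ is the poset whose elements are the pairs $(K,\alpha)$, $K\subseteq E(G)$, $\alpha\in S_p$, modulo $(K,\alpha)\sim(L,\beta)$ iff $K=L$ and $T_K\alpha=T_L\beta$, ordered by $(K,\alpha)\le(L,\beta)$ iff $K\subseteq L$ and $T_K\alpha\subseteq T_L\beta$, with rank of $(K,\alpha)$ equal to $|K|$, together with an adjoined least element of rank $-1$. -}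

module Defs where

open import Data.Nat using (ℕ; _<_)
open import Data.Fin using (Fin)
open import Data.Fin.Subset using (Subset; _∈_; _⊆_; ∣_∣)
open import Data.Fin.Permutation using (Permutation; _∘ₚ_; id; transpose; _≈_)
open import Data.Product using (Σ; ∃; ∃-syntax; _×_; _,_; proj₁; proj₂)
open import Data.Sum using (_⊎_)
open import Data.List using (List; []; _∷_)
open import Data.List.Relation.Unary.All using (All)
open import Function.Definitions using (Injective)
open import Relation.Binary.PropositionalEquality using (_≡_)
open import Relation.Binary.Construct.Closure.ReflexiveTransitive using (Star)
open import Relation.Nullary using (¬_)

-- S_p : permutations of the vertex set Fin p (vertex i of the paper is Fin index i-1)
Perm : ℕ → Set
Perm p = Permutation p p

-- group product in S_p: (σ · τ)(x) = σ (τ x)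
_·_ : ∀ {p} → Perm p → Perm p → Perm p
σ · τ = τ ∘ₚ σ

infixr 7 _·_

-- A finite simple graph on vertex set Fin p with q edges, the edges indexed by Fin q.
-- Edge e is the unordered pair {i , j} with ends e = (i , j), i < j.
record SimpleGraph (p q : ℕ) : Set where
  field
    ends    : Fin q → Fin p × Fin p
    ordered : ∀ e → proj₁ (ends e) Data.Fin.< proj₂ (ends e)
    distinct : Injective _≡_ _≡_ ends
open SimpleGraph public

module _ {p q : ℕ} (G : SimpleGraph p q) where

  Adj : Fin p → Fin p → Set
  Adj i j = ∃[ e ] (ends G e ≡ (i , j) ⊎ ends G e ≡ (j , i))

  Connected : Set
  Connected = ∀ (i j : Fin p) → Star Adj i j

  τ : Fin q → Perm p
  τ e = transpose (proj₁ (ends G e)) (proj₂ (ends G e))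

  eval : List (Fin q) → Perm p
  eval []      = id
  eval (e ∷ w) = τ e · eval w

  -- γ ∈ T_K = ⟨ τ_e : e ∈ K ⟩ (transpositions are involutions, so the
  -- generated subgroup consists of the finite products of generators;
  -- the empty product gives the trivial group for K = ∅)
  InT : Subset q → Perm p → Set
  InT K γ = Σ (List (Fin q)) λ w → All (_∈ K) w × eval w ≈ γ

  InCoset : Subset q → Perm p → Perm p → Set
  InCoset K α x = ∃[ γ ] (InT K γ × x ≈ γ · α)

  -- representatives (K , α) of the (proper) faces of the graphicahedron
  record Face : Set where
    constructor ⟪_,_⟫
    field
      edges : Subset q
      perm  : Perm p
  open Face public

  rank : Face → ℕ
  rank F = ∣ edges F ∣

  _∼_ : Face → Face → Set
  F ∼ H = edges F ≡ edges H
        × (∀ x → InCoset (edges F) (perm F) x → InCoset (edges H) (perm H) x)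
        × (∀ x → InCoset (edges H) (perm H) x → InCoset (edges F) (perm F) x)

  _≤F_ : Face → Face → Set
  F ≤F H = edges F ⊆ edges H
         × (∀ x → InCoset (edges F) (perm F) x → InCoset (edges H) (perm H) x)

  -- vertices of the 1-skeleton: rank-0 faces (the adjoined least element has rank -1)
  SkVertex : Set
  SkVertex = Σ Face λ F → rank F ≡ 0

  SkAdj : SkVertex → SkVertex → Set
  SkAdj u v = ¬ (proj₁ u ∼ proj₁ v)
            × ∃[ F ] (rank F ≡ 1 × proj₁ u ≤F F × proj₁ v ≤F F)

  CayAdj : Perm p → Perm p → Set
  CayAdj γ₁ γ₂ = ∃[ e ] (γ₂ ≈ τ e · γ₁)

  -- graph isomorphism between the 1-skeleton (vertices up to ∼) and 𝒢(G)
  -- (vertices up to extensional equality of permutations)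
  record SkeletonIso : Set where
    field
      f      : SkVertex → Perm p
      f-cong : ∀ u v → proj₁ u ∼ proj₁ v → f u ≈ f v
      f-inj  : ∀ u v → f u ≈ f v → proj₁ u ∼ proj₁ v
      f-surj : ∀ γ → ∃[ u ] (f u ≈ γ)
      f-adj  : ∀ u v → SkAdj u v → CayAdj (f u) (f v)
      f-adj⁻ : ∀ u v → CayAdj (f u) (f v) → SkAdj u v

-- Rank-0 faces (∅, α) have the singleton cosets {α}, so they are in bijection with S_p.
-- A rank-1 face ({e}, μ) has coset {μ, τ_e μ}, since T_{e} = {id, τ_e}; hence two distinct
-- vertices lie below a common edge-face iff they differ by left multiplication by some τ_e,
-- which is adjacency in the Cayley graph.
module Submission where

open import Defs
open import Data.Nat using (ℕ)
open import Data.Nat.Properties using (suc-injective)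
open import Data.Fin using (Fin; zero; suc; _≟_)
open import Data.Fin.Properties using (<⇒≢)
open import Data.Fin.Subset using (Subset; _∈_; _∉_; _⊆_; ∣_∣; inside; outside; ⁅_⁆; ⊥)
open import Data.Fin.Subset.Properties using (∣⊥∣≡0; ∣⁅x⁆∣≡1; x∈⁅x⁆; x∈⁅y⁆⇒x≡y; Empty-unique)
open import Data.Fin.Permutation using (_⟨$⟩ʳ_; _⟨$⟩ˡ_; inverseʳ; id; _≈_)
import Data.Fin.Permutation.Components as PC
open import Data.Vec.Base using (_∷_; here; there)
open import Data.Product using (∃-syntax; _,_; proj₁; proj₂)
open import Data.Sum using (_⊎_; inj₁; inj₂)
open import Data.List using (List; []; _∷_)
open import Data.List.Relation.Unary.All as All using (All; []; _∷_)
open import Relation.Nullary using (¬_; yes; no; Dec; contradiction)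
open import Relation.Binary.PropositionalEquality using (_≡_; _≢_; refl; sym; trans; cong; module ≡-Reasoning)
open ≡-Reasoning

module _ {n : ℕ} where

  transpose-mapsˡ : (i j : Fin n) → PC.transpose i j i ≡ j
  transpose-mapsˡ i j with i ≟ i
  ... | yes _  = refl
  ... | no i≢i = contradiction refl i≢i

  transpose-mapsʳ : (i j : Fin n) → PC.transpose i j j ≡ i
  transpose-mapsʳ i j with j ≟ i
  ... | yes j≡i = j≡i
  ... | no _ with j ≟ j
  ...   | yes _  = refl
  ...   | no j≢j = contradiction refl j≢j

  transpose-fixes : (i j k : Fin n) → k ≢ i → k ≢ j → PC.transpose i j k ≡ k
  transpose-fixes i j k k≢i k≢j with k ≟ i
  ... | yes k≡i = contradiction k≡i k≢i
  ... | no _ with k ≟ j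
  ...   | yes k≡j = contradiction k≡j k≢j
  ...   | no _    = refl

  transpose-sym : (i j k : Fin n) → PC.transpose i j k ≡ PC.transpose j i k
  transpose-sym i j k = by-cases (k ≟ i) (k ≟ j)
    where
    by-cases : Dec (k ≡ i) → Dec (k ≡ j) → PC.transpose i j k ≡ PC.transpose j i k
    by-cases (yes refl) _          = trans (transpose-mapsˡ k j) (sym (transpose-mapsʳ j k))
    by-cases (no _)     (yes refl) = trans (transpose-mapsʳ i k) (sym (transpose-mapsˡ k i))
    by-cases (no k≢i)   (no k≢j)   =
      trans (transpose-fixes i j k k≢i k≢j) (sym (transpose-fixes j i k k≢j k≢i))

  transpose-involutive : (i j k : Fin n) → PC.transpose i j (PC.transpose i j k) ≡ k
  transpose-involutive i j k = trans (cong (PC.transpose i j) (transpose-sym i j k)) (PC.transpose-inverse i j)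

∣p∣≡0⇒x∉p : ∀ {n} {p : Subset n} {x : Fin n} → ∣ p ∣ ≡ 0 → x ∉ p
∣p∣≡0⇒x∉p {p = inside  ∷ p} ()
∣p∣≡0⇒x∉p {p = outside ∷ p} ∣p∣≡0 (there x∈p) = ∣p∣≡0⇒x∉p ∣p∣≡0 x∈p

∣p∣≡0⇒p≡⊥ : ∀ {n} {p : Subset n} → ∣ p ∣ ≡ 0 → p ≡ ⊥
∣p∣≡0⇒p≡⊥ ∣p∣≡0 = Empty-unique λ (_ , x∈p) → ∣p∣≡0⇒x∉p ∣p∣≡0 x∈p

∣p∣≡1⇒p⊆⁅x⁆ : ∀ {n} {p : Subset n} → ∣ p ∣ ≡ 1 → ∃[ x ] p ⊆ ⁅ x ⁆
∣p∣≡1⇒p⊆⁅x⁆ {p = inside ∷ p} ∣p∣≡1 = zero , λ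
  { here        → here
  ; (there x∈p) → contradiction x∈p (∣p∣≡0⇒x∉p (suc-injective ∣p∣≡1)) }
∣p∣≡1⇒p⊆⁅x⁆ {p = outside ∷ p} ∣p∣≡1 with ∣p∣≡1⇒p⊆⁅x⁆ ∣p∣≡1
... | x , p⊆⁅x⁆ = suc x , λ { (there y∈p) → there (p⊆⁅x⁆ y∈p) }

-- _≈_ unfolds to a pointwise equation from which Agda cannot infer the permutations
-- involved, so they are explicit arguments throughout.
module Symmetric (p : ℕ) where

  ·-cancelʳ-id : (π α : Perm p) → π · α ≈ α → π ≈ id
  ·-cancelʳ-id π α πα≈α i = begin
    π ⟨$⟩ʳ i                    ≡⟨ cong (π ⟨$⟩ʳ_) (inverseʳ α) ⟨
    π ⟨$⟩ʳ (α ⟨$⟩ʳ (α ⟨$⟩ˡ i))  ≡⟨ πα≈α (α ⟨$⟩ˡ i) ⟩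
    α ⟨$⟩ʳ (α ⟨$⟩ˡ i)           ≡⟨ inverseʳ α ⟩
    i                           ∎

  involution-swap : (t μ x : Perm p) → t · t ≈ id → x ≈ t · μ → μ ≈ t · x
  involution-swap t μ x t·t≈id x≈tμ i =
    trans (sym (t·t≈id (μ ⟨$⟩ʳ i))) (cong (t ⟨$⟩ʳ_) (sym (x≈tμ i)))

module _ {p q : ℕ} (G : SimpleGraph p q) where

  open Symmetric p

  τ-involutive : ∀ e → τ G e · τ G e ≈ id
  τ-involutive e = transpose-involutive (proj₁ (ends G e)) (proj₂ (ends G e))

  τ≉id : ∀ e → ¬ (τ G e ≈ id)
  τ≉id e τ≈id = <⇒≢ (ordered G e) (trans (sym (τ≈id i)) (transpose-mapsˡ i j))
    where i = proj₁ (ends G e); j = proj₂ (ends G e)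

  InT-empty : ∀ K γ → (∀ {e} → e ∉ K) → InT G K γ → γ ≈ id
  InT-empty K γ K-empty ([]    , _       , id≈γ) i = sym (id≈γ i)
  InT-empty K γ K-empty (_ ∷ _ , e∈K ∷ _ , _)     = contradiction e∈K K-empty

  eval-⁅e⁆ : ∀ e (w : List (Fin q)) → All (_∈ ⁅ e ⁆) w → eval G w ≈ id ⊎ eval G w ≈ τ G e
  eval-⁅e⁆ e []      []              = inj₁ λ _ → refl
  eval-⁅e⁆ e (f ∷ w) (f∈⁅e⁆ ∷ w∈⁅e⁆) with x∈⁅y⁆⇒x≡y e f∈⁅e⁆ | eval-⁅e⁆ e w w∈⁅e⁆
  ... | refl | inj₁ w≈id = inj₂ λ i → cong (τ G e ⟨$⟩ʳ_) (w≈id i)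
  ... | refl | inj₂ w≈τ  = inj₁ λ i → trans (cong (τ G e ⟨$⟩ʳ_) (w≈τ i)) (τ-involutive e i)

  InT-⁅e⁆ : ∀ K e γ → K ⊆ ⁅ e ⁆ → InT G K γ → γ ≈ id ⊎ γ ≈ τ G e
  InT-⁅e⁆ K e γ K⊆⁅e⁆ (w , w∈K , w≈γ) with eval-⁅e⁆ e w (All.map K⊆⁅e⁆ w∈K)
  ... | inj₁ w≈id = inj₁ λ i → trans (sym (w≈γ i)) (w≈id i)
  ... | inj₂ w≈τ  = inj₂ λ i → trans (sym (w≈γ i)) (w≈τ i)

  ≈⇒InCoset : ∀ K α x → x ≈ α → InCoset G K α x
  ≈⇒InCoset K α x x≈α = id , ([] , [] , λ _ → refl) , x≈α

  τ·⇒InCoset : ∀ K α x e → e ∈ K → x ≈ τ G e · α → InCoset G K α x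
  τ·⇒InCoset K α x e e∈K x≈τα = τ G e , (e ∷ [] , e∈K ∷ [] , λ _ → refl) , x≈τα

  InCoset-rank0 : ∀ K α x → ∣ K ∣ ≡ 0 → InCoset G K α x → x ≈ α
  InCoset-rank0 K α x ∣K∣≡0 (γ , γ∈T , x≈γα) i =
    trans (x≈γα i) (InT-empty K γ (∣p∣≡0⇒x∉p ∣K∣≡0) γ∈T (α ⟨$⟩ʳ i))

  InCoset-⁅e⁆ : ∀ M μ x e → M ⊆ ⁅ e ⁆ → InCoset G M μ x → x ≈ μ ⊎ x ≈ τ G e · μ
  InCoset-⁅e⁆ M μ x e M⊆⁅e⁆ (γ , γ∈T , x≈γμ) with InT-⁅e⁆ M e γ M⊆⁅e⁆ γ∈T
  ... | inj₁ γ≈id = inj₁ λ i → trans (x≈γμ i) (γ≈id (μ ⟨$⟩ʳ i))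
  ... | inj₂ γ≈τ  = inj₂ λ i → trans (x≈γμ i) (γ≈τ (μ ⟨$⟩ʳ i))

  vertex-perm : SkVertex G → Perm p
  vertex-perm (F , _) = perm F

  vertex-perm-cong : ∀ u v → _∼_ G (proj₁ u) (proj₁ v) → vertex-perm u ≈ vertex-perm v
  vertex-perm-cong (⟪ K , α ⟫ , _) (⟪ L , β ⟫ , ∣L∣≡0) (_ , αT⊆βT , _) =
    InCoset-rank0 L β α ∣L∣≡0 (αT⊆βT α (≈⇒InCoset K α α λ _ → refl))

  vertex-perm-injective : ∀ u v → vertex-perm u ≈ vertex-perm v → _∼_ G (proj₁ u) (proj₁ v)
  vertex-perm-injective (⟪ K , α ⟫ , ∣K∣≡0) (⟪ L , β ⟫ , ∣L∣≡0) α≈β =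
    trans (∣p∣≡0⇒p≡⊥ ∣K∣≡0) (sym (∣p∣≡0⇒p≡⊥ ∣L∣≡0)) ,
    (λ x x∈Tα → ≈⇒InCoset L β x λ i → trans (InCoset-rank0 K α x ∣K∣≡0 x∈Tα i) (α≈β i)) ,
    (λ x x∈Tβ → ≈⇒InCoset K α x λ i → trans (InCoset-rank0 L β x ∣L∣≡0 x∈Tβ i) (sym (α≈β i)))

  vertex-perm-surjective : ∀ γ → ∃[ u ] vertex-perm u ≈ γ
  vertex-perm-surjective γ = (⟪ ⊥ , γ ⟫ , ∣⊥∣≡0 q) , λ _ → refl

  vertex≤F : ∀ K α M μ → ∣ K ∣ ≡ 0 → InCoset G M μ α → _≤F_ G ⟪ K , α ⟫ ⟪ M , μ ⟫
  vertex≤F K α M μ ∣K∣≡0 (γ , γ∈T , α≈γμ) =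
    (λ e∈K → contradiction e∈K (∣p∣≡0⇒x∉p ∣K∣≡0)) ,
    (λ x x∈Tα → γ , γ∈T , λ i → trans (InCoset-rank0 K α x ∣K∣≡0 x∈Tα i) (α≈γμ i))

  InCoset-⁅e⁆-distinct : ∀ M μ α β e → M ⊆ ⁅ e ⁆ → InCoset G M μ α → InCoset G M μ β →
                         ¬ (α ≈ β) → β ≈ τ G e · α
  InCoset-⁅e⁆-distinct M μ α β e M⊆⁅e⁆ α∈Tμ β∈Tμ α≉β
    with InCoset-⁅e⁆ M μ α e M⊆⁅e⁆ α∈Tμ | InCoset-⁅e⁆ M μ β e M⊆⁅e⁆ β∈Tμ
  ... | inj₁ α≈μ  | inj₁ β≈μ  = contradiction (λ i → trans (α≈μ i) (sym (β≈μ i))) α≉β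
  ... | inj₂ α≈τμ | inj₂ β≈τμ = contradiction (λ i → trans (α≈τμ i) (sym (β≈τμ i))) α≉β
  ... | inj₁ α≈μ  | inj₂ β≈τμ = λ i → trans (β≈τμ i) (cong (τ G e ⟨$⟩ʳ_) (sym (α≈μ i)))
  ... | inj₂ α≈τμ | inj₁ β≈μ  =
        λ i → trans (β≈μ i) (involution-swap (τ G e) μ α (τ-involutive e) α≈τμ i)

  skeleton-adj⇒cayley-adj : ∀ u v → SkAdj G u v → CayAdj G (vertex-perm u) (vertex-perm v)
  skeleton-adj⇒cayley-adj u@(⟪ K , α ⟫ , _) v@(⟪ L , β ⟫ , _)
                          (u≁v , ⟪ M , μ ⟫ , ∣M∣≡1 , (_ , Tα⊆Tμ) , (_ , Tβ⊆Tμ))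
    with ∣p∣≡1⇒p⊆⁅x⁆ ∣M∣≡1
  ... | e , M⊆⁅e⁆ = e , InCoset-⁅e⁆-distinct M μ α β e M⊆⁅e⁆
                          (Tα⊆Tμ α (≈⇒InCoset K α α λ _ → refl))
                          (Tβ⊆Tμ β (≈⇒InCoset L β β λ _ → refl))
                          (λ α≈β → u≁v (vertex-perm-injective u v α≈β))

  cayley-adj⇒skeleton-adj : ∀ u v → CayAdj G (vertex-perm u) (vertex-perm v) → SkAdj G u v
  cayley-adj⇒skeleton-adj u@(⟪ K , α ⟫ , ∣K∣≡0) v@(⟪ L , β ⟫ , ∣L∣≡0) (e , β≈τα) =
    (λ u∼v → τ≉id e (·-cancelʳ-id (τ G e) α λ i →
                       trans (sym (β≈τα i)) (sym (vertex-perm-cong u v u∼v i)))) ,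
    ⟪ ⁅ e ⁆ , α ⟫ , ∣⁅x⁆∣≡1 e ,
    vertex≤F K α ⁅ e ⁆ α ∣K∣≡0 (≈⇒InCoset ⁅ e ⁆ α α λ _ → refl) ,
    vertex≤F L β ⁅ e ⁆ α ∣L∣≡0 (τ·⇒InCoset ⁅ e ⁆ α β e (x∈⁅x⁆ e) β≈τα)

theorem2 : ∀ {p q : ℕ} (G : SimpleGraph p q) → Connected G → SkeletonIso G
theorem2 G _ = record
  { f      = vertex-perm G
  ; f-cong = vertex-perm-cong G
  ; f-inj  = vertex-perm-injective G
  ; f-surj = vertex-perm-surjective G
  ; f-adj  = skeleton-adj⇒cayley-adj G
  ; f-adj⁻ = cayley-adj⇒skeleton-adj G
  }
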